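{- Let $\mathbf{C}$ be a quasitopos, with $\mathcal{M}$ its class of regular monomorphisms. Then AGREE $\prec_{\mathbf{C}}$ PBPO$^+$: for every AGREE rule $\rho$ there is a PBPO$^+$ rule $\tau$ with $\Rightarrow^{\rho}_{\mathrm{AGREE}}=\Rightarrow^{\tau}_{\mathrm{PBPO}^+}$.
   Context: A quasitopos is a category with all finite limits and colimits that is locally cartesian closed and has a regular-subobject classifier. Its regular monos form a stable system of monics $\mathcal{M}$, and it has an $\mathcal{M}$-partial map classifier $(T,\eta)$: a functor $T$ and natural transformation $\eta:\mathrm{Id}\to T$ with each $\eta_X\in\mathcal{M}$ such that for every span $A\xleftarrow{m}X\xrightarrow{f}B$ with $m\in\mathcal{M}$ there is a unique $[m,f]:A\to T(B)$ with $\eta_B\circ f=[m,f]\circ m$ a pullback. AGREE rule $\rho$: a span $L\xleftarrow{l}K\xrightarrow{r}R$ together with $t_K:K\to K'$ in $\mathcal{M}$. AGREE step $G_L\Rightarrow^{\rho,m}_{\mathrm{AGREE}}G_R$ for a match $m:L\to G_L$ in $\mathcal{M}$: $G_L\xleftarrow{g_L}G_K\to K'$ is a pullback of $G_L\xrightarrow{[m,1_L]}T(L)\xleftarrow{[t_K,l]}K'$, $u:K\to G_K$ is the induced morphism, and $G_R$ is a pushout of $G_K\xleftarrow{u}K\xrightarrow{r}R$. $\Rightarrow^{\rho}_{\mathrm{AGREE}}$ is the union over all $m\in\mathcal{M}$. PBPO$^+$ rule $\tau$: $l:K\to L$, $r:K\to R$, $t_L:L\to L'$, $t_K:K\to K'$,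 $l':K'\to L'$ with $t_L l=l't_K$ a pullback. PBPO$^+$ step with $m:L\to G_L$, $\alpha:G_L\to L'$: $\alpha m=t_L$ and $L\xleftarrow{1_L}L\xrightarrow{m}G_L$ is a pullback of $L\xrightarrow{t_L}L'\xleftarrow{\alpha}G_L$; $G_L\xleftarrow{g_L}G_K\xrightarrow{u'}K'$ is a pullback of $\alpha,l'$; $u$ is the unique morphism with $u'u=t_K$; $G_R$ is a pushout of $G_K\xleftarrow{u}K\xrightarrow{r}R$. $\Rightarrow^{\tau}_{\mathrm{PBPO}^+}$ is the union over all $m,\alpha$. -}

module Defs where

open import Level using (Level; _⊔_; suc)
open import Data.Product using (Σ; Σ-syntax; _×_; _,_; proj₁; proj₂)
open import Relation.Binary.PropositionalEquality using (_≡_)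

record Category (o ℓ : Level) : Set (suc (o ⊔ ℓ)) where
  infixr 9 _∘_
  field
    Obj   : Set o
    Hom   : Obj → Obj → Set ℓ
    id    : ∀ {A} → Hom A A
    _∘_   : ∀ {A B C} → Hom B C → Hom A B → Hom A C
    identityˡ : ∀ {A B} {f : Hom A B} → id ∘ f ≡ f
    identityʳ : ∀ {A B} {f : Hom A B} → f ∘ id ≡ f
    assoc     : ∀ {A B C D} {f : Hom A B} {g : Hom B C} {h : Hom C D} →
                (h ∘ g) ∘ f ≡ h ∘ (g ∘ f)

module _ {o ℓ : Level} (C : Category o ℓ) where
  open Category C

  record IsPullback {A B Cc P : Obj} (f : Hom A Cc) (g : Hom B Cc)
                    (p₁ : Hom P A) (p₂ : Hom P B) : Set (o ⊔ ℓ) where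
    field
      commute   : f ∘ p₁ ≡ g ∘ p₂
      universal : ∀ {X} (h : Hom X A) (k : Hom X B) → f ∘ h ≡ g ∘ k →
                  Σ[ u ∈ Hom X P ] ((p₁ ∘ u ≡ h × p₂ ∘ u ≡ k) ×
                    (∀ (v : Hom X P) → p₁ ∘ v ≡ h → p₂ ∘ v ≡ k → v ≡ u))

  record IsPushout {A B Cc P : Obj} (f : Hom Cc A) (g : Hom Cc B)
                   (i₁ : Hom A P) (i₂ : Hom B P) : Set (o ⊔ ℓ) where
    field
      commute   : i₁ ∘ f ≡ i₂ ∘ g
      universal : ∀ {X} (h : Hom A X) (k : Hom B X) → h ∘ f ≡ k ∘ g →
                  Σ[ u ∈ Hom P X ] ((u ∘ i₁ ≡ h × u ∘ i₂ ≡ k) ×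
                    (∀ (v : Hom P X) → v ∘ i₁ ≡ h → v ∘ i₂ ≡ k → v ≡ u))

  record IsEqualizer {E A B : Obj} (e : Hom E A) (f g : Hom A B) : Set (o ⊔ ℓ) where
    field
      equality  : f ∘ e ≡ g ∘ e
      universal : ∀ {X} (h : Hom X A) → f ∘ h ≡ g ∘ h →
                  Σ[ u ∈ Hom X E ] (e ∘ u ≡ h × (∀ (v : Hom X E) → e ∘ v ≡ h → v ≡ u))

  record IsCoequalizer {A B Q : Obj} (f g : Hom A B) (c : Hom B Q) : Set (o ⊔ ℓ) where
    field
      equality  : c ∘ f ≡ c ∘ g
      universal : ∀ {X} (h : Hom B X) → h ∘ f ≡ h ∘ g →
                  Σ[ u ∈ Hom Q X ] (u ∘ c ≡ h × (∀ (v : Hom Q X) → v ∘ c ≡ h → v ≡ u))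

  RegularMono : ∀ {A B} → Hom A B → Set (o ⊔ ℓ)
  RegularMono {A} {B} m = Σ[ Cc ∈ Obj ] Σ[ f ∈ Hom B Cc ] Σ[ g ∈ Hom B Cc ] IsEqualizer m f g

  IsTerminal : Obj → Set (o ⊔ ℓ)
  IsTerminal T = ∀ X → Σ[ t ∈ Hom X T ] (∀ (v : Hom X T) → v ≡ t)

  IsInitial : Obj → Set (o ⊔ ℓ)
  IsInitial I = ∀ X → Σ[ t ∈ Hom I X ] (∀ (v : Hom I X) → v ≡ t)

  -- Exponential of (X , x) and (Y , y) in the slice category C / A.
  -- The slice product of (E , e) and (X , x) is their pullback over A.
  record SliceExponential {A X Y : Obj} (x : Hom X A) (y : Hom Y A) : Set (o ⊔ ℓ) where
    field
      E    : Obj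
      e    : Hom E A
      Q    : Obj
      q₁   : Hom Q E
      q₂   : Hom Q X
      isPb : IsPullback e x q₁ q₂
      ev   : Hom Q Y
      ev-over : y ∘ ev ≡ e ∘ q₁
      curry : ∀ {Z W} (z : Hom Z A) (w₁ : Hom W Z) (w₂ : Hom W X) →
              IsPullback z x w₁ w₂ →
              (k : Hom W Y) → y ∘ k ≡ z ∘ w₁ →
              Σ[ c ∈ Hom Z E ]
                ((e ∘ c ≡ z ×
                  (∀ (n : Hom W Q) → q₁ ∘ n ≡ c ∘ w₁ → q₂ ∘ n ≡ w₂ → ev ∘ n ≡ k)) ×
                 (∀ (c' : Hom Z E) → e ∘ c' ≡ z →
                  (∀ (n : Hom W Q) → q₁ ∘ n ≡ c' ∘ w₁ → q₂ ∘ n ≡ w₂ → ev ∘ n ≡ k) →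
                  c' ≡ c))

  record IsQuasitopos : Set (o ⊔ ℓ) where
    field
      terminal    : Σ[ T ∈ Obj ] IsTerminal T
      pullback    : ∀ {A B Cc} (f : Hom A Cc) (g : Hom B Cc) →
                    Σ[ P ∈ Obj ] Σ[ p₁ ∈ Hom P A ] Σ[ p₂ ∈ Hom P B ] IsPullback f g p₁ p₂
      equalizer   : ∀ {A B} (f g : Hom A B) →
                    Σ[ E ∈ Obj ] Σ[ e ∈ Hom E A ] IsEqualizer e f g
      initial     : Σ[ I ∈ Obj ] IsInitial I
      pushout     : ∀ {A B Cc} (f : Hom Cc A) (g : Hom Cc B) →
                    Σ[ P ∈ Obj ] Σ[ i₁ ∈ Hom A P ] Σ[ i₂ ∈ Hom B P ] IsPushout f g i₁ i₂
      coequalizer : ∀ {A B} (f g : Hom A B) →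
                    Σ[ Q ∈ Obj ] Σ[ c ∈ Hom B Q ] IsCoequalizer f g c
      -- locally cartesian closed: every slice C / A is cartesian closed
      -- (terminal objects and products in slices exist by finite limits)
      exponential : ∀ {A X Y} (x : Hom X A) (y : Hom Y A) → SliceExponential x y
      Ω           : Obj
      true        : Hom (proj₁ terminal) Ω
      true-regular : RegularMono true
      classify    : ∀ {A X} (m : Hom A X) → RegularMono m →
                    Σ[ χ ∈ Hom X Ω ]
                      (IsPullback χ true m (proj₁ (proj₂ terminal A)) ×
                       (∀ (χ' : Hom X Ω) → IsPullback χ' true m (proj₁ (proj₂ terminal A)) →
                        χ' ≡ χ))

  record PartialMapClassifier : Set (o ⊔ ℓ) where
    field
      T₀   : Obj → Obj
      T₁   : ∀ {A B} → Hom A B → Hom (T₀ A) (T₀ B)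
      T-id : ∀ {A} → T₁ (id {A}) ≡ id
      T-∘  : ∀ {A B Cc} {f : Hom A B} {g : Hom B Cc} → T₁ (g ∘ f) ≡ T₁ g ∘ T₁ f
      η    : ∀ A → Hom A (T₀ A)
      η-natural : ∀ {A B} (f : Hom A B) → T₁ f ∘ η A ≡ η B ∘ f
      η-regular : ∀ A → RegularMono (η A)
      classify : ∀ {A X B} (m : Hom X A) (f : Hom X B) → RegularMono m →
                 Σ[ c ∈ Hom A (T₀ B) ]
                   (IsPullback c (η B) m f ×
                    (∀ (c' : Hom A (T₀ B)) → IsPullback c' (η B) m f → c' ≡ c))

  record AgreeRule : Set (o ⊔ ℓ) where
    field
      L K R K' : Obj
      l  : Hom K L
      r  : Hom K R
      tK : Hom K K'
      tK-regular : RegularMono tK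

  module _ (P : PartialMapClassifier) (ρ : AgreeRule) where
    open PartialMapClassifier P
    open AgreeRule ρ

    record AgreeStepWith (GL GR : Obj) (m : Hom L GL) (m-regular : RegularMono m) : Set (o ⊔ ℓ) where
      field
        GK  : Obj
        gL  : Hom GK GL
        g'  : Hom GK K'
        isPb : IsPullback (proj₁ (classify m id m-regular)) (proj₁ (classify tK l tK-regular)) gL g'
        u   : Hom K GK
        u-l : gL ∘ u ≡ m ∘ l
        u-t : g' ∘ u ≡ tK
        gR  : Hom GK GR
        w   : Hom R GR
        isPo : IsPushout u r gR w

    AgreeStep : Obj → Obj → Set (o ⊔ ℓ)
    AgreeStep GL GR = Σ[ m ∈ Hom L GL ] Σ[ mr ∈ RegularMono m ] AgreeStepWith GL GR m mr

  record PBPORule : Set (o ⊔ ℓ) where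
    field
      L K R L' K' : Obj
      l  : Hom K L
      r  : Hom K R
      tL : Hom L L'
      tK : Hom K K'
      l' : Hom K' L'
      isPb : IsPullback tL l' l tK

  module _ (τ : PBPORule) where
    open PBPORule τ

    record PBPOStepWith (GL GR : Obj) (m : Hom L GL) (α : Hom GL L') : Set (o ⊔ ℓ) where
      field
        α-m   : α ∘ m ≡ tL
        matchPb : IsPullback tL α id m
        GK  : Obj
        gL  : Hom GK GL
        u'  : Hom GK K'
        isPb' : IsPullback α l' gL u'
        u   : Hom K GK
        u-t : u' ∘ u ≡ tK
        u-unique : ∀ (v : Hom K GK) → u' ∘ v ≡ tK → v ≡ u
        gR  : Hom GK GR
        w   : Hom R GR
        isPo : IsPushout u r gR w

    PBPOStep : Obj → Obj → Set (o ⊔ ℓ)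
    PBPOStep GL GR = Σ[ m ∈ Hom L GL ] Σ[ α ∈ Hom GL L' ] PBPOStepWith GL GR m α

-- Take τ with L' = T(L), t_L = η_L and l' = [t_K , l]; the rule square is then the
-- classifying pullback of [t_K , l]. A PBPO+ match (m , α) for τ says that m is the
-- pullback of η_L along α, so m is regular and α = [m , 1_L] by uniqueness of
-- classifying maps; conversely an AGREE match m yields such a pair with α = [m , 1_L].
-- The two context pullbacks then coincide, and it remains to see that the morphism
-- u : K → G_K is the same in both steps: any v with u' ∘ v = t_K also satisfies
-- g_L ∘ v = m ∘ l (it factors through the match pullback), and the legs of a pullback
-- are jointly monic.
module Submission where

open import Defs
open import Level using (Level)
open import Data.Product using (Σ; _×_; _,_; proj₁; proj₂)
open import Relation.Binary.PropositionalEquality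
  using (_≡_; refl; sym; trans; cong; subst; module ≡-Reasoning)

module _ {o ℓ : Level} (C : Category o ℓ) where
  open Category C
  open ≡-Reasoning

  IsPullback-swap : ∀ {A B Cc P} {f : Hom A Cc} {g : Hom B Cc} {p₁ : Hom P A} {p₂ : Hom P B} →
                    IsPullback C f g p₁ p₂ → IsPullback C g f p₂ p₁
  IsPullback-swap pb = record
    { commute   = sym (IsPullback.commute pb)
    ; universal = λ h k eq →
        let (u , (p₁u , p₂u) , unique) = IsPullback.universal pb k h (sym eq)
        in u , (p₂u , p₁u) , λ v p₂v p₁v → unique v p₁v p₂v
    }

  IsPullback-jointly-monic : ∀ {A B Cc P X} {f : Hom A Cc} {g : Hom B Cc}
                               {p₁ : Hom P A} {p₂ : Hom P B} →
                             IsPullback C f g p₁ p₂ → (v v' : Hom X P) →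
                             p₁ ∘ v ≡ p₁ ∘ v' → p₂ ∘ v ≡ p₂ ∘ v' → v ≡ v'
  IsPullback-jointly-monic {f = f} {g} {p₁} {p₂} pb v v' p₁v p₂v =
    trans (unique v refl refl) (sym (unique v' (sym p₁v) (sym p₂v)))
    where
    square : f ∘ (p₁ ∘ v) ≡ g ∘ (p₂ ∘ v)
    square = begin
      f ∘ (p₁ ∘ v)  ≡⟨ sym assoc ⟩
      (f ∘ p₁) ∘ v  ≡⟨ cong (_∘ v) (IsPullback.commute pb) ⟩
      (g ∘ p₂) ∘ v  ≡⟨ assoc ⟩
      g ∘ (p₂ ∘ v)  ∎
    unique = proj₂ (proj₂ (IsPullback.universal pb (p₁ ∘ v) (p₂ ∘ v) square))

  RegularMono-pullback : ∀ {A B P X} {e : Hom A B} {α : Hom X B} {p₁ : Hom P A} {m : Hom P X} →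
                         RegularMono C e → IsPullback C e α p₁ m → RegularMono C m
  RegularMono-pullback {P = P} {X = X} {e = e} {α} {p₁} {m} (D , f , g , eq) pb =
    D , f ∘ α , g ∘ α , record { equality = equalises ; universal = universal }
    where
    open IsEqualizer eq renaming (equality to fe≡ge; universal to e-universal)
    open IsPullback pb renaming (commute to ep₁≡αm; universal to pb-universal)

    equalises : (f ∘ α) ∘ m ≡ (g ∘ α) ∘ m
    equalises = begin
      (f ∘ α) ∘ m   ≡⟨ assoc ⟩
      f ∘ (α ∘ m)   ≡⟨ cong (f ∘_) (sym ep₁≡αm) ⟩
      f ∘ (e ∘ p₁)  ≡⟨ sym assoc ⟩
      (f ∘ e) ∘ p₁  ≡⟨ cong (_∘ p₁) fe≡ge ⟩
      (g ∘ e) ∘ p₁  ≡⟨ assoc ⟩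
      g ∘ (e ∘ p₁)  ≡⟨ cong (g ∘_) ep₁≡αm ⟩
      g ∘ (α ∘ m)   ≡⟨ sym assoc ⟩
      (g ∘ α) ∘ m   ∎

    universal : ∀ {Y} (h : Hom Y X) → (f ∘ α) ∘ h ≡ (g ∘ α) ∘ h →
                Σ (Hom Y P) λ u → m ∘ u ≡ h × (∀ v → m ∘ v ≡ h → v ≡ u)
    universal h fαh≡gαh =
      let (k , ek≡αh , k-unique) = e-universal (α ∘ h) (trans (sym assoc) (trans fαh≡gαh assoc))
          (u , (p₁u≡k , mu≡h) , u-unique) = pb-universal k h ek≡αh
          ep₁v≡αh : ∀ v → m ∘ v ≡ h → e ∘ (p₁ ∘ v) ≡ α ∘ h
          ep₁v≡αh v mv≡h = begin
            e ∘ (p₁ ∘ v)  ≡⟨ sym assoc ⟩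
            (e ∘ p₁) ∘ v  ≡⟨ cong (_∘ v) ep₁≡αm ⟩
            (α ∘ m) ∘ v   ≡⟨ assoc ⟩
            α ∘ (m ∘ v)   ≡⟨ cong (α ∘_) mv≡h ⟩
            α ∘ h         ∎
      in u , mu≡h , λ v mv≡h → u-unique v (k-unique (p₁ ∘ v) (ep₁v≡αh v mv≡h)) mv≡h

  lift-through-match : ∀ {L L' K K' GL GK} {tL : Hom L L'} {α : Hom GL L'} {m : Hom L GL}
                         {l' : Hom K' L'} {gL : Hom GK GL} {u' : Hom GK K'}
                         {l : Hom K L} {tK : Hom K K'} →
                       IsPullback C tL α id m → IsPullback C α l' gL u' →
                       tL ∘ l ≡ l' ∘ tK →
                       (v : Hom K GK) → u' ∘ v ≡ tK → gL ∘ v ≡ m ∘ l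
  lift-through-match {tL = tL} {α} {m} {l'} {gL} {u'} {l} {tK} match context rule v u'v≡tK =
    begin
      gL ∘ v  ≡⟨ sym m∘w≡gLv ⟩
      m ∘ w   ≡⟨ cong (m ∘_) (trans (sym identityˡ) id∘w≡l) ⟩
      m ∘ l   ∎
    where
    square : tL ∘ l ≡ α ∘ (gL ∘ v)
    square = begin
      tL ∘ l          ≡⟨ rule ⟩
      l' ∘ tK         ≡⟨ cong (l' ∘_) (sym u'v≡tK) ⟩
      l' ∘ (u' ∘ v)   ≡⟨ sym assoc ⟩
      (l' ∘ u') ∘ v   ≡⟨ cong (_∘ v) (sym (IsPullback.commute context)) ⟩
      (α ∘ gL) ∘ v    ≡⟨ assoc ⟩
      α ∘ (gL ∘ v)    ∎
    factorisation = IsPullback.universal match l (gL ∘ v) square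
    w = proj₁ factorisation
    id∘w≡l = proj₁ (proj₁ (proj₂ factorisation))
    m∘w≡gLv = proj₂ (proj₁ (proj₂ factorisation))

module AgreeAsPBPO {o ℓ : Level} (C : Category o ℓ) (P : PartialMapClassifier C)
                   (ρ : AgreeRule C) where
  open Category C
  open PartialMapClassifier P
  open AgreeRule ρ

  l'ρ : Hom K' (T₀ L)
  l'ρ = proj₁ (classify tK l tK-regular)

  rule-pullback : IsPullback C (η L) l'ρ l tK
  rule-pullback = IsPullback-swap C (proj₁ (proj₂ (classify tK l tK-regular)))

  τ : PBPORule C
  τ = record { L = L ; K = K ; R = R ; L' = T₀ L ; K' = K' ; l = l ; r = r
             ; tL = η L ; tK = tK ; l' = l'ρ ; isPb = rule-pullback }

  agree⇒pbpo : ∀ {GL GR} → AgreeStep C P ρ GL GR → PBPOStep C τ GL GR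
  agree⇒pbpo (m , m-regular , step) = m , α , record
    { α-m      = trans (IsPullback.commute α-classifies) identityʳ
    ; matchPb  = match
    ; GK = GK ; gL = gL ; u' = g' ; isPb' = isPb ; u = u ; u-t = u-t
    ; u-unique = λ v g'v≡tK → IsPullback-jointly-monic C isPb v u
        (trans (lift-through-match C match isPb (IsPullback.commute rule-pullback) v g'v≡tK)
               (sym u-l))
        (trans g'v≡tK (sym u-t))
    ; gR = gR ; w = w ; isPo = isPo }
    where
    open AgreeStepWith step
    α = proj₁ (classify m id m-regular)
    α-classifies = proj₁ (proj₂ (classify m id m-regular))
    match = IsPullback-swap C α-classifies

  pbpo⇒agree : ∀ {GL GR} → PBPOStep C τ GL GR → AgreeStep C P ρ GL GR
  pbpo⇒agree (m , α , step) = m , m-regular , record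
    { GK = GK ; gL = gL ; g' = u'
    ; isPb = subst (λ a → IsPullback C a l'ρ gL u') α≡[m,id] isPb'
    ; u = u
    ; u-l = lift-through-match C matchPb isPb' (IsPullback.commute rule-pullback) u u-t
    ; u-t = u-t
    ; gR = gR ; w = w ; isPo = isPo }
    where
    open PBPOStepWith step
    m-regular = RegularMono-pullback C (η-regular L) matchPb
    α≡[m,id] : α ≡ proj₁ (classify m id m-regular)
    α≡[m,id] = proj₂ (proj₂ (classify m id m-regular)) α (IsPullback-swap C matchPb)

corollary5 : ∀ {o ℓ : Level} (C : Category o ℓ) → IsQuasitopos C →
               (P : PartialMapClassifier C) → (ρ : AgreeRule C) →
               Σ (PBPORule C) (λ τ → ∀ (GL GR : Category.Obj C) →
                 (AgreeStep C P ρ GL GR → PBPOStep C τ GL GR) ×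
                 (PBPOStep C τ GL GR → AgreeStep C P ρ GL GR))
corollary5 C _ P ρ = τ , λ _ _ → agree⇒pbpo , pbpo⇒agree
  where open AgreeAsPBPO C P ρ
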